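{- If an ideal $\mathcal I$ on $\omega$ is not HL, then there exists $X\in\mathcal I^+$ such that $\mathcal{ED}\le_{\mathrm K}\mathcal I\restriction X$.
   Context: Ideals are proper, closed under subsets and finite unions, and contain all finite sets; $\mathcal I^+=\mathcal P(\omega)\setminus\mathcal I$; $\mathcal I\restriction X=\{A\cap X:A\in\mathcal I\}$, an ideal on $X$. $\mathcal{ED}$ is the ideal on $\omega\times\omega$ of sets $A$ for which there are $k,m$ with $|A\cap(\{n\}\times\omega)|\le k$ for all $n\ge m$. For ideals $\mathcal I$ on $X$ and $\mathcal J$ on $Y$ (countable), $\mathcal I\le_{\mathrm K}\mathcal J$ means there is $f:Y\to X$ with $f^{ -1}[A]\in\mathcal J$ for all $A\in\mathcal I$. A tree is an initial subset of $(2^{<\omega},\subseteq)$ without maximal elements, perfect if every node has two incompatible extensions in it; $\mathbf S$ is the set of perfect trees; $p\restriction A=\{s\in p\cap2^n:n\in A\}$. An ideal $\mathcal I$ on $\omega$ is HL if for every $c:2^{<\omega}\to2$ there are $p\in\mathbf S$ and $A\in\mathcal I^+$ with $c$ constant on $p\restriction A$. -}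

module Defs where

open import Data.Nat using (ℕ; _≤_; _<_)
open import Data.Bool using (Bool; true; false)
open import Data.List using (List; []; _∷_; _++_; length)
open import Data.List.Membership.Propositional using (_∈_)
open import Data.List.Relation.Unary.All using (All)
open import Data.List.Relation.Unary.Unique.Propositional using (Unique)
open import Data.Product using (Σ; ∃; _×_; _,_; proj₁)
open import Relation.Binary.PropositionalEquality using (_≡_)
open import Relation.Nullary using (¬_)
open import Function.Bundles using (_⇔_)

Subset : Set → Set
Subset X = X → Bool

_⊆_ : {X : Set} → Subset X → Subset X → Set
A ⊆ B = ∀ x → A x ≡ true → B x ≡ true

_∪_ : {X : Set} → Subset X → Subset X → Subset X
(A ∪ B) x with A x
... | true  = true
... | false = B x

full : {X : Set} → Subset X
full _ = true

Finite : {X : Set} → Subset X → Set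
Finite {X} S = Σ (List X) λ l → ∀ x → S x ≡ true → x ∈ l

Family : Set → Set₁
Family X = Subset X → Set

record IsIdeal {X : Set} (I : Family X) : Set₁ where
  field
    proper    : ¬ I full
    downward  : ∀ A B → B ⊆ A → I A → I B
    union     : ∀ A B → I A → I B → I (A ∪ B)
    finite    : ∀ A → Finite A → I A

Positive : {X : Set} → Family X → Subset X → Set
Positive I A = ¬ I A

Elem : Subset ℕ → Set
Elem X = Σ ℕ λ n → X n ≡ true

Restrict : Family ℕ → (X : Subset ℕ) → Family (Elem X)
Restrict I X B = Σ (Subset ℕ) λ A → I A × (∀ y → (B y ≡ true) ⇔ (A (proj₁ y) ≡ true))

_≤K_ : {X Y : Set} → Family X → Family Y → Set
_≤K_ {X} {Y} I J = Σ (Y → X) λ f → ∀ A → I A → J (λ y → A (f y))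

AtMost : {X : Set} → ℕ → Subset X → Set
AtMost {X} k S = (l : List X) → Unique l → All (λ x → S x ≡ true) l → length l ≤ k

ED : Family (ℕ × ℕ)
ED A = Σ ℕ λ k → Σ ℕ λ m → ∀ n → m ≤ n → AtMost k (λ j → A (n , j))

Node : Set
Node = List Bool

_⊑_ : Node → Node → Set
s ⊑ t = Σ Node λ u → s ++ u ≡ t

_⊏_ : Node → Node → Set
s ⊏ t = (s ⊑ t) × (length s < length t)

Incompatible : Node → Node → Set
Incompatible s t = ¬ (s ⊑ t) × ¬ (t ⊑ s)

record IsTree (p : Subset Node) : Set where
  field
    root    : p [] ≡ true
    initial : ∀ s t → s ⊑ t → p t ≡ true → p s ≡ true
    nomax   : ∀ s → p s ≡ true → Σ Node λ t → (p t ≡ true) × (s ⊏ t)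

record IsPerfectTree (p : Subset Node) : Set where
  field
    tree    : IsTree p
    perfect : ∀ s → p s ≡ true →
              Σ Node λ t → Σ Node λ u →
                (p t ≡ true) × (p u ≡ true) × (s ⊑ t) × (s ⊑ u) × Incompatible t u

ConstantOn : (Node → Bool) → Subset Node → Subset ℕ → Set
ConstantOn c p A = Σ Bool λ i → ∀ s → p s ≡ true → A (length s) ≡ true → c s ≡ i

HL : Family ℕ → Set
HL I = (c : Node → Bool) →
       Σ (Subset Node) λ p → Σ (Subset ℕ) λ A →
         IsPerfectTree p × Positive I A × ConstantOn c p A

{-# OPTIONS --safe #-}
-- Fix a colouring c with no perfect tree homogeneous on an I-positive set of levels. Say that n is
-- covered at L if some node t of length ≤ L has every node of height n in its cone coloured 1.
-- Cones are perfect trees, so the levels covered at L form a set in I. Conversely, if no element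
-- a of A is covered at 0 and no later element of A is covered at a + 1, a perfect tree coloured 0
-- on the levels in A can be grown fork by fork, so A ∈ I ("escaping" sets).
-- If some positive S is eventually uncovered at every level, cut ω into blocks, each starting
-- beyond the point where S stops being covered at the start of the previous block: a subset of S
-- meeting every block in at most k points is the union of 2k escaping sets, so the block map
-- witnesses ED ≤K I ↾ S. Otherwise n ↦ (least level covering n, n) witnesses ED ≤K I: the preimage
-- of a set with at most k points in each late column is covered at a fixed level, never covered, or
-- eventually uncovered at every level, and each of these parts is in I.
module Submission where

open import Defs
open import Data.Nat using (ℕ)
open import Data.Product using (Σ; _×_)
open import Relation.Nullary using (¬_)
open import Level using (0ℓ)
open import Axiom.ExcludedMiddle using (ExcludedMiddle)

open import Axiom.DoubleNegationElimination using (em⇒dne)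
open import Data.Bool using (Bool; true; false; not)
open import Data.Bool.Properties using (not-¬; ¬-not)
open import Data.Empty using (⊥-elim)
open import Data.List using (List; []; _∷_; _++_; _∷ʳ_; length; map; upTo)
open import Data.List.Membership.Propositional using (_∈_)
open import Data.List.Membership.Propositional.Properties using (∈-map⁺; ∈-++⁺ˡ; ∈-++⁺ʳ; ∈-upTo⁺)
open import Data.List.Properties using (length-++; ++-assoc; ++-identityʳ; ∷-injective; ∷ʳ-injective)
open import Data.List.Relation.Unary.All as All using (All; []; _∷_)
open import Data.List.Relation.Unary.AllPairs using ([]; _∷_)
open import Data.List.Relation.Unary.Any using (here; there)
open import Data.List.Relation.Unary.Unique.Propositional using (Unique)
open import Data.Nat using (zero; suc; _+_; _≤_; _<_; z≤n; s≤s; _≤?_; _<?_)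
open import Data.Nat.Properties
open import Data.Product using (∃; _,_; proj₁; proj₂)
open import Data.Sum using (_⊎_; inj₁; inj₂)
open import Function using (_∘_; case_of_)
open import Function.Bundles using (mk⇔)
open import Relation.Binary.PropositionalEquality using (_≡_; _≢_; refl; sym; trans; cong; subst)
open import Relation.Nullary using (yes; no; does)
open import Relation.Unary using (Decidable)

⊑-refl : ∀ s → s ⊑ s
⊑-refl s = [] , ++-identityʳ s

⊑-trans : ∀ {s t u} → s ⊑ t → t ⊑ u → s ⊑ u
⊑-trans {s} (a , refl) (b , refl) = a ++ b , sym (++-assoc s a b)

[]⊑ : ∀ t → [] ⊑ t
[]⊑ t = t , refl

⊑-∷ʳ : ∀ s b → s ⊑ (s ∷ʳ b)
⊑-∷ʳ s b = b ∷ [] , refl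

length-∷ʳ : ∀ (s : Node) b → length (s ∷ʳ b) ≡ suc (length s)
length-∷ʳ s b = trans (length-++ s) (+-comm (length s) 1)

⊑⇒length≤ : ∀ {s t} → s ⊑ t → length s ≤ length t
⊑⇒length≤ {s} (a , refl) = subst (length s ≤_) (sym (length-++ s)) (m≤m+n (length s) (length a))

⊑∧length≡⇒≡ : ∀ {s t} → s ⊑ t → length s ≡ length t → s ≡ t
⊑∧length≡⇒≡ {s} ([] , s++[]≡t) _ = trans (sym (++-identityʳ s)) s++[]≡t
⊑∧length≡⇒≡ {s} (_ ∷ _ , refl) eq = ⊥-elim (m+1+n≢m (length s) (sym (trans eq (length-++ s))))

⊑-by-length : ∀ s t {u} → s ⊑ u → t ⊑ u → length s ≤ length t → s ⊑ t
⊑-by-length []      t       _          _       _         = []⊑ t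
⊑-by-length (_ ∷ _) []      _          _       ()
⊑-by-length (x ∷ s) (_ ∷ t) (a , refl) (b , eq) (s≤s le) with refl , eq′ ← ∷-injective eq
  with d , s++d≡t ← ⊑-by-length s t (a , refl) (b , eq′) le
  = d , cong (x ∷_) s++d≡t

⊑-total-below : ∀ s t {u} → s ⊑ u → t ⊑ u → s ⊑ t ⊎ t ⊑ s
⊑-total-below s t s⊑u t⊑u with ≤-total (length s) (length t)
... | inj₁ le = inj₁ (⊑-by-length s t s⊑u t⊑u le)
... | inj₂ le = inj₂ (⊑-by-length t s t⊑u s⊑u le)

∷ʳ-⊑-∷ʳ : ∀ s {b b′} → (s ∷ʳ b) ⊑ (s ∷ʳ b′) → b ≡ b′
∷ʳ-⊑-∷ʳ s {b} {b′} p =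
  proj₂ (∷ʳ-injective s s (⊑∧length≡⇒≡ p (trans (length-∷ʳ s b) (sym (length-∷ʳ s b′)))))

∷ʳ-incompatible : ∀ s → Incompatible (s ∷ʳ false) (s ∷ʳ true)
∷ʳ-incompatible s = (λ p → false≢true (∷ʳ-⊑-∷ʳ s p)) , (λ p → false≢true (sym (∷ʳ-⊑-∷ʳ s p)))
  where
  false≢true : false ≢ true
  false≢true ()

⊏-∷ʳ : ∀ {s e} b → s ⊑ e → s ⊏ (e ∷ʳ b)
⊏-∷ʳ {s} {e} b s⊑e =
  ⊑-trans s⊑e (⊑-∷ʳ e b) , subst (length s <_) (sym (length-∷ʳ e b)) (s≤s (⊑⇒length≤ s⊑e))

nodesUpTo : ℕ → List Node
nodesUpTo zero    = [] ∷ []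
nodesUpTo (suc L) = [] ∷ (map (true ∷_) (nodesUpTo L) ++ map (false ∷_) (nodesUpTo L))

∈-nodesUpTo : ∀ L t → length t ≤ L → t ∈ nodesUpTo L
∈-nodesUpTo zero    []          _        = here refl
∈-nodesUpTo (suc L) []          _        = here refl
∈-nodesUpTo (suc L) (true ∷ t)  (s≤s le) = there (∈-++⁺ˡ (∈-map⁺ (true ∷_) (∈-nodesUpTo L t le)))
∈-nodesUpTo (suc L) (false ∷ t) (s≤s le) =
  there (∈-++⁺ʳ (map (true ∷_) (nodesUpTo L)) (∈-map⁺ (false ∷_) (∈-nodesUpTo L t le)))

least-witness : (P : ℕ → Set) → Decidable P → ∃ P → ∃ λ m → P m × (∀ k → k < m → ¬ P k)
least-witness P P? (n , Pn) = search 0 n (λ _ ()) Pn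
  where
  search : ∀ i f → (∀ k → k < i → ¬ P k) → P (i + f) → ∃ λ m → P m × (∀ k → k < m → ¬ P k)
  search i zero    below P[i+0] = i , subst P (+-identityʳ i) P[i+0] , below
  search i (suc f) below P[i+1+f] with P? i
  ... | yes Pi = i , Pi , below
  ... | no ¬Pi = search (suc i) f below′ (subst P (+-suc i f) P[i+1+f])
    where
    below′ : ∀ k → k < suc i → ¬ P k
    below′ k k<1+i with m<1+n⇒m<n∨m≡n k<1+i
    ... | inj₁ k<i  = below k k<i
    ... | inj₂ refl = ¬Pi

parity : ℕ → Bool
parity zero    = true
parity (suc n) = not (parity n)

same-parity⇒2+≤ : ∀ x y → parity x ≡ parity y → x < y → 2 + x ≤ y
same-parity⇒2+≤ x (suc y) same x<1+y with m<1+n⇒m<n∨m≡n x<1+y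
... | inj₁ x<y  = s≤s x<y
... | inj₂ refl = ⊥-elim (not-¬ refl same)

AtMost-mono : ∀ {X : Set} {k} {S S′ : Subset X} → S′ ⊆ S → AtMost k S → AtMost k S′
AtMost-mono S′⊆S atMost l unique inS′ = atMost l unique (All.map (λ {x} → S′⊆S x) inS′)

AtMost-empty : ∀ {X : Set} {k} {S : Subset X} → (∀ x → S x ≢ true) → AtMost k S
AtMost-empty empty []      _ _          = z≤n
AtMost-empty empty (x ∷ _) _ (Sx ∷ _) = ⊥-elim (empty x Sx)

HasHomogeneousTree : Family ℕ → (Node → Bool) → Set
HasHomogeneousTree I c =
  Σ (Subset Node) λ p → Σ (Subset ℕ) λ A → IsPerfectTree p × Positive I A × ConstantOn c p A

module IdealProperties {X : Set} {I : Family X} (isI : IsIdeal I) where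
  open IsIdeal isI

  ∪-introˡ : ∀ (A B : Subset X) x → A x ≡ true → (A ∪ B) x ≡ true
  ∪-introˡ A B x Ax with A x
  ∪-introˡ A B x refl | true = refl

  ∪-introʳ : ∀ (A B : Subset X) x → B x ≡ true → (A ∪ B) x ≡ true
  ∪-introʳ A B x Bx with A x
  ... | true  = refl
  ... | false = Bx

  ⊆-∪ : ∀ {A B P : Subset X} → I A → I B → (∀ x → P x ≡ true → A x ≡ true ⊎ B x ≡ true) → I P
  ⊆-∪ {A} {B} {P} A∈I B∈I split = downward (A ∪ B) P P⊆A∪B (union A B A∈I B∈I)
    where
    P⊆A∪B : P ⊆ (A ∪ B)
    P⊆A∪B x Px with split x Px
    ... | inj₁ Ax = ∪-introˡ A B x Ax
    ... | inj₂ Bx = ∪-introʳ A B x Bx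

  ∅∈ : ∀ {P : Subset X} → (∀ x → P x ≢ true) → I P
  ∅∈ {P} empty = finite P ([] , λ x Px → ⊥-elim (empty x Px))

bounded∈ : ∀ {I : Family ℕ} → IsIdeal I → ∀ {P} M → (∀ n → P n ≡ true → n < M) → I P
bounded∈ isI {P} M below = IsIdeal.finite isI P (upTo M , λ n Pn → ∈-upTo⁺ (below n Pn))

module _ (em : ExcludedMiddle 0ℓ) where

  ⟦_⟧ : Set → Bool
  ⟦ P ⟧ = does (em {P})

  ⟦⟧-intro : ∀ {P} → P → ⟦ P ⟧ ≡ true
  ⟦⟧-intro {P} p with em {P}
  ... | yes _ = refl
  ... | no ¬p = ⊥-elim (¬p p)

  ⟦⟧-elim : ∀ {P} → ⟦ P ⟧ ≡ true → P
  ⟦⟧-elim {P} eq with em {P}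
  ⟦⟧-elim {P} refl | yes p = p

  dne : ∀ {P : Set} → ¬ ¬ P → P
  dne = em⇒dne em

  by-cases : ∀ (P : Set) {R : Set} → (P → R) → (¬ P → R) → R
  by-cases P if-P if-¬P with em {P}
  ... | yes p = if-P p
  ... | no ¬p = if-¬P ¬p

  bounded-or-unbounded : (P : Subset ℕ) →
    (∃ λ M → ∀ n → M ≤ n → P n ≢ true) ⊎ (∀ m → ∃ λ n → m ≤ n × P n ≡ true)
  bounded-or-unbounded P with em {∃ λ M → ∀ n → M ≤ n → P n ≢ true}
  ... | yes bounded = inj₁ bounded
  ... | no ¬bounded  = inj₂ λ m → dne λ ¬above → ¬bounded (m , λ n m≤n Pn → ¬above (n , m≤n , Pn))

  distinct-members : ∀ {S : Subset ℕ} → (∀ m → ∃ λ n → m ≤ n × S n ≡ true) →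
    ∀ N → Σ (List ℕ) λ l → ∃ λ B → Unique l × All (λ x → S x ≡ true) l × length l ≡ N × All (_< B) l
  distinct-members unbounded zero    = [] , 0 , [] , [] , refl , []
  distinct-members unbounded (suc N)
    with l , B , unique , inS , length≡ , below ← distinct-members unbounded N
    with n , B≤n , Sn ← unbounded B
    = n ∷ l , suc n ,
      All.map (λ x<B x≡n → <-irrefl (sym x≡n) (<-≤-trans x<B B≤n)) below ∷ unique ,
      Sn ∷ inS , cong suc length≡ ,
      ≤-refl ∷ All.map (λ x<B → <-trans x<B (s≤s B≤n)) below

  AtMost⇒bounded : ∀ k (S : Subset ℕ) → AtMost k S → ∃ λ M → ∀ n → M ≤ n → S n ≢ true
  AtMost⇒bounded k S atMost with bounded-or-unbounded S
  ... | inj₁ bounded = bounded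
  ... | inj₂ unbounded with l , _ , unique , inS , length≡ , _ ← distinct-members unbounded (suc k)
    = ⊥-elim (<-irrefl refl (subst (_≤ k) length≡ (atMost l unique inS)))

  ⋃-list∈ : ∀ {X Y : Set} {I : Family X} → IsIdeal I → (F : Y → Subset X) → (∀ y → I (F y)) →
            (l : List Y) → I (λ x → ⟦ Σ Y (λ y → y ∈ l × F y x ≡ true) ⟧)
  ⋃-list∈ isI F F∈I [] = ∅∈ λ x e → case ⟦⟧-elim e of λ { (_ , () , _) }
    where open IdealProperties isI
  ⋃-list∈ isI F F∈I (y ∷ l) = ⊆-∪ (F∈I y) (⋃-list∈ isI F F∈I l) split
    where
    open IdealProperties isI
    split : ∀ x → ⟦ Σ _ (λ z → z ∈ y ∷ l × F z x ≡ true) ⟧ ≡ true →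
            F y x ≡ true ⊎ ⟦ Σ _ (λ z → z ∈ l × F z x ≡ true) ⟧ ≡ true
    split x e with ⟦⟧-elim e
    ... | _ , here refl , Fyx = inj₁ Fyx
    ... | z , there z∈l , Fzx = inj₂ (⟦⟧-intro (z , z∈l , Fzx))

  cone : Node → Subset Node
  cone t s = ⟦ s ⊑ t ⊎ t ⊑ s ⟧

  cone-upper-bound : ∀ t s → cone t s ≡ true → Σ Node λ u → s ⊑ u × t ⊑ u
  cone-upper-bound t s s∈cone with ⟦⟧-elim s∈cone
  ... | inj₁ s⊑t = t , s⊑t , ⊑-refl t
  ... | inj₂ t⊑s = s , ⊑-refl s , t⊑s

  cone-perfect : ∀ t → IsPerfectTree (cone t)
  cone-perfect t = record
    { tree = record
      { root    = ⟦⟧-intro (inj₁ ([]⊑ t))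
      ; initial = λ s s′ s⊑s′ s′∈cone → initial s s′ s⊑s′ (⟦⟧-elim s′∈cone)
      ; nomax   = λ s s∈cone → let u , s⊑u , t⊑u = cone-upper-bound t s s∈cone in
                    u ∷ʳ false , child u false t⊑u , ⊏-∷ʳ false s⊑u
      }
    ; perfect = λ s s∈cone → let u , s⊑u , t⊑u = cone-upper-bound t s s∈cone in
        u ∷ʳ false , u ∷ʳ true , child u false t⊑u , child u true t⊑u ,
        ⊑-trans s⊑u (⊑-∷ʳ u false) , ⊑-trans s⊑u (⊑-∷ʳ u true) , ∷ʳ-incompatible u
    }
    where
    child : ∀ u b → t ⊑ u → cone t (u ∷ʳ b) ≡ true
    child u b t⊑u = ⟦⟧-intro (inj₂ (⊑-trans t⊑u (⊑-∷ʳ u b)))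

    initial : ∀ s s′ → s ⊑ s′ → s′ ⊑ t ⊎ t ⊑ s′ → cone t s ≡ true
    initial s s′ s⊑s′ (inj₁ s′⊑t) = ⟦⟧-intro (inj₁ (⊑-trans s⊑s′ s′⊑t))
    initial s s′ s⊑s′ (inj₂ t⊑s′) = ⟦⟧-intro (⊑-total-below s t s⊑s′ t⊑s′)

  module Colouring (I : Family ℕ) (isI : IsIdeal I) (c : Node → Bool)
                   (no-tree : ¬ HasHomogeneousTree I c) where
    open IsIdeal isI
    open IdealProperties isI

    ConeOnes : Node → ℕ → Set
    ConeOnes t n = ∀ u → cone t u ≡ true → length u ≡ n → c u ≡ true

    coneOnes∈I : ∀ t → I (λ n → ⟦ ConeOnes t n ⟧)
    coneOnes∈I t = dne λ positive →
      no-tree (cone t , _ , cone-perfect t , positive , true , λ u u∈cone n∈ → ⟦⟧-elim n∈ u u∈cone refl)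

    Covered : ℕ → ℕ → Set
    Covered L n = Σ Node λ t → length t ≤ L × ConeOnes t n

    Covered-mono : ∀ {L L′ n} → L ≤ L′ → Covered L n → Covered L′ n
    Covered-mono L≤L′ (t , |t|≤L , ones) = t , ≤-trans |t|≤L L≤L′ , ones

    CoveredAt : ℕ → Subset ℕ
    CoveredAt L n = ⟦ Covered L n ⟧

    covered∈I : ∀ L → I (CoveredAt L)
    covered∈I L = downward _ _ ⊆⋃ (⋃-list∈ isI _ coneOnes∈I (nodesUpTo L))
      where
      ⊆⋃ : ∀ n → CoveredAt L n ≡ true →
           ⟦ Σ Node (λ t → t ∈ nodesUpTo L × ⟦ ConeOnes t n ⟧ ≡ true) ⟧ ≡ true
      ⊆⋃ n covered with t , |t|≤L , ones ← ⟦⟧-elim covered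
        = ⟦⟧-intro (t , ∈-nodesUpTo L t |t|≤L , ⟦⟧-intro ones)

    uncovered-extension : ∀ {s n} → length s ≤ n → ¬ ConeOnes s n →
                          Σ Node λ e → s ⊑ e × length e ≡ n × c e ≡ false
    uncovered-extension {s} {n} |s|≤n ¬ones = dne λ none → ¬ones λ u u∈cone |u|≡n →
      ¬-not λ cu≡false → none (u , s⊑ u u∈cone |u|≡n , |u|≡n , cu≡false)
      where
      s⊑ : ∀ u → cone s u ≡ true → length u ≡ n → s ⊑ u
      s⊑ u u∈cone |u|≡n with ⟦⟧-elim u∈cone
      ... | inj₂ s⊑u = s⊑u
      ... | inj₁ u⊑s = subst (s ⊑_) (sym (⊑∧length≡⇒≡ u⊑s (≤-antisym (⊑⇒length≤ u⊑s)
                         (subst (length s ≤_) (sym |u|≡n) |s|≤n)))) (⊑-refl s)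

    Escaping : Subset ℕ → Set
    Escaping A = (∀ a → A a ≡ true → ¬ Covered 0 a)
               × (∀ a a′ → A a ≡ true → A a′ ≡ true → a < a′ → ¬ Covered (suc a) a′)

    module EscapingTree {A : Subset ℕ} (escaping : Escaping A)
                        (unbounded : ∀ m → ∃ λ a → m ≤ a × A a ≡ true) where

      next : ∀ m → ∃ λ a → (m ≤ a × A a ≡ true) × (∀ x → x < a → ¬ (m ≤ x × A x ≡ true))
      next m = least-witness _ (λ _ → em) (unbounded m)

      mutual
        stemHeight : ℕ → ℕ
        stemHeight zero    = 0
        stemHeight (suc k) = suc (forkHeight k)

        forkHeight : ℕ → ℕ
        forkHeight k = proj₁ (next (stemHeight k))

      stem≤fork : ∀ k → stemHeight k ≤ forkHeight k
      stem≤fork k = proj₁ (proj₁ (proj₂ (next (stemHeight k))))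

      fork∈A : ∀ k → A (forkHeight k) ≡ true
      fork∈A k = proj₂ (proj₁ (proj₂ (next (stemHeight k))))

      A-avoids : ∀ k x → stemHeight k ≤ x → x < forkHeight k → A x ≢ true
      A-avoids k x stem≤x x<fork Ax = proj₂ (proj₂ (next (stemHeight k))) x x<fork (stem≤x , Ax)

      fork-uncovered : ∀ k → ¬ Covered (stemHeight k) (forkHeight k)
      fork-uncovered zero    = proj₁ escaping _ (fork∈A zero)
      fork-uncovered (suc k) = proj₂ escaping _ _ (fork∈A k) (fork∈A (suc k)) (stem≤fork (suc k))

      -- σ ∈ 2^{<ω} indexes the stems of the tree; each stem extends to a fork coloured 0
      -- at the next level of A, whose two one-step extensions are the next stems.
      mutual
        stem : List Bool → Node
        stem []      = []
        stem (i ∷ σ) = fork σ ∷ʳ i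

        length-stem : ∀ σ → length (stem σ) ≡ stemHeight (length σ)
        length-stem []      = refl
        length-stem (i ∷ σ) = trans (length-∷ʳ (fork σ) i) (cong suc (length-fork σ))

        fork-spec : ∀ σ → Σ Node λ e → stem σ ⊑ e × length e ≡ forkHeight (length σ) × c e ≡ false
        fork-spec σ = uncovered-extension (≤-trans (≤-reflexive (length-stem σ)) (stem≤fork _))
          λ ones → fork-uncovered (length σ) (stem σ , ≤-reflexive (length-stem σ) , ones)

        fork : List Bool → Node
        fork σ = proj₁ (fork-spec σ)

        length-fork : ∀ σ → length (fork σ) ≡ forkHeight (length σ)
        length-fork σ = proj₁ (proj₂ (proj₂ (fork-spec σ)))

      stem⊑fork : ∀ σ → stem σ ⊑ fork σ
      stem⊑fork σ = proj₁ (proj₂ (fork-spec σ))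

      fork-colour : ∀ σ → c (fork σ) ≡ false
      fork-colour σ = proj₂ (proj₂ (proj₂ (fork-spec σ)))

      tree : Subset Node
      tree s = ⟦ Σ (List Bool) (λ σ → s ⊑ stem σ) ⟧

      tree-perfect : IsPerfectTree tree
      tree-perfect = record
        { tree = record
          { root    = ⟦⟧-intro ([] , []⊑ [])
          ; initial = λ s s′ s⊑s′ s′∈tree → let σ , s′⊑stem = ⟦⟧-elim s′∈tree in
                        ⟦⟧-intro (σ , ⊑-trans s⊑s′ s′⊑stem)
          ; nomax   = λ s s∈tree → let σ , s⊑stem = ⟦⟧-elim s∈tree in
                        stem (false ∷ σ) , child false σ , ⊏-∷ʳ false (⊑-trans s⊑stem (stem⊑fork σ))
          }
        ; perfect = λ s s∈tree → let σ , s⊑stem = ⟦⟧-elim s∈tree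
                                     s⊑fork = ⊑-trans s⊑stem (stem⊑fork σ) in
            stem (false ∷ σ) , stem (true ∷ σ) , child false σ , child true σ ,
            ⊑-trans s⊑fork (⊑-∷ʳ _ false) , ⊑-trans s⊑fork (⊑-∷ʳ _ true) , ∷ʳ-incompatible (fork σ)
        }
        where
        child : ∀ i σ → tree (stem (i ∷ σ)) ≡ true
        child i σ = ⟦⟧-intro (i ∷ σ , ⊑-refl _)

      prefix-of-stem : ∀ i σ s → s ⊑ stem (i ∷ σ) → length s < length (stem (i ∷ σ)) → s ⊑ fork σ
      prefix-of-stem i σ s s⊑stem |s|<|stem| = ⊑-by-length s (fork σ) s⊑stem (⊑-∷ʳ (fork σ) i)
        (≤-pred (subst (length s <_) (length-∷ʳ (fork σ) i) |s|<|stem|))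

      fork-prefix-colour : ∀ σ s → s ⊑ fork σ → A (length s) ≡ true → c s ≡ false
      fork-prefix-colour σ s s⊑fork A|s|
        with length s <? length (stem σ) | length s <? forkHeight (length σ)
      fork-prefix-colour [] s s⊑fork A|s| | yes () | _
      fork-prefix-colour (i ∷ σ) s s⊑fork A|s| | yes |s|<|stem| | _ =
        fork-prefix-colour σ s (prefix-of-stem i σ s s⊑stem |s|<|stem|) A|s|
        where
        s⊑stem : s ⊑ stem (i ∷ σ)
        s⊑stem = ⊑-by-length s (stem (i ∷ σ)) s⊑fork (stem⊑fork (i ∷ σ)) (<⇒≤ |s|<|stem|)
      ... | no |s|≮|stem| | yes |s|<fork =
        ⊥-elim (A-avoids (length σ) (length s)
                  (subst (_≤ length s) (length-stem σ) (≮⇒≥ |s|≮|stem|)) |s|<fork A|s|)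
      ... | no _ | no |s|≮fork = subst (λ x → c x ≡ false) (sym s≡fork) (fork-colour σ)
        where
        s≡fork : s ≡ fork σ
        s≡fork = ⊑∧length≡⇒≡ s⊑fork (≤-antisym (⊑⇒length≤ s⊑fork)
                   (subst (_≤ length s) (sym (length-fork σ)) (≮⇒≥ |s|≮fork)))

      A∈I : I A
      A∈I = dne λ A∉I → no-tree (tree , A , tree-perfect , A∉I , false , colour)
        where
        colour : ∀ s → tree s ≡ true → A (length s) ≡ true → c s ≡ false
        colour s s∈tree A|s| with σ , s⊑stem ← ⟦⟧-elim s∈tree
          = fork-prefix-colour σ s (⊑-trans s⊑stem (stem⊑fork σ)) A|s|

    escaping∈I : ∀ {A} → Escaping A → I A
    escaping∈I {A} escaping with bounded-or-unbounded A
    ... | inj₁ (M , beyond) = bounded∈ isI M λ n An → ≰⇒> λ M≤n → beyond n M≤n An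
    ... | inj₂ unbounded    = EscapingTree.A∈I escaping unbounded

    EventuallyUncovered : Subset ℕ → Set
    EventuallyUncovered S = ∀ L → ∃ λ M → ∀ n → M ≤ n → S n ≡ true → ¬ Covered L n

    module BlockMap (S : Subset ℕ) (uncovered : EventuallyUncovered S) where

      threshold : ℕ → ℕ
      threshold L = proj₁ (uncovered L)

      beyond-threshold : ∀ L n → threshold L ≤ n → S n ≡ true → ¬ Covered L n
      beyond-threshold L = proj₂ (uncovered L)

      -- From blockStart (j + 1) on, S is not covered at level blockStart j.
      blockStart : ℕ → ℕ
      blockStart zero    = 0
      blockStart (suc j) = suc (threshold (blockStart j) + blockStart j)

      threshold≤blockStart : ∀ j → threshold (blockStart j) ≤ blockStart (suc j)
      threshold≤blockStart j = ≤-trans (m≤m+n _ (blockStart j)) (n≤1+n _)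

      blockStart-< : ∀ j → blockStart j < blockStart (suc j)
      blockStart-< j = s≤s (m≤n+m (blockStart j) _)

      blockStart-mono : ∀ {j j′} → j ≤ j′ → blockStart j ≤ blockStart j′
      blockStart-mono {j} {j′} j≤j′ with m≤n⇒m<n∨m≡n j≤j′
      ... | inj₂ refl = ≤-refl
      blockStart-mono {j} {suc j′} _ | inj₁ j<1+j′ =
        ≤-trans (blockStart-mono (≤-pred j<1+j′)) (<⇒≤ (blockStart-< j′))

      ≤blockStart : ∀ j → j ≤ blockStart j
      ≤blockStart zero    = z≤n
      ≤blockStart (suc j) = ≤-trans (s≤s (≤blockStart j)) (blockStart-< j)

      block-spec : ∀ n → ∃ λ j → n < blockStart (suc j) × (∀ k → k < j → ¬ n < blockStart (suc k))
      block-spec n = least-witness _ (λ j → n <? blockStart (suc j))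
                       (n , ≤-trans (s≤s (≤blockStart n)) (blockStart-< n))

      block : ℕ → ℕ
      block n = proj₁ (block-spec n)

      <blockEnd : ∀ n → n < blockStart (suc (block n))
      <blockEnd n = proj₁ (proj₂ (block-spec n))

      blockStart≤ : ∀ n → blockStart (block n) ≤ n
      blockStart≤ n = first-block-below (block n) (proj₂ (proj₂ (block-spec n)))
        where
        first-block-below : ∀ j → (∀ k → k < j → ¬ n < blockStart (suc k)) → blockStart j ≤ n
        first-block-below zero    _          = z≤n
        first-block-below (suc j) not-before = ≮⇒≥ (not-before j ≤-refl)

      block-mono : ∀ {a a′} → a ≤ a′ → block a ≤ block a′
      block-mono {a} {a′} a≤a′ = ≮⇒≥ λ later → <-irrefl refl
        (<-≤-trans (<blockEnd a′) (≤-trans (blockStart-mono later) (≤-trans (blockStart≤ a) a≤a′)))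

      InLaterBlocks : Subset ℕ → Set
      InLaterBlocks P = ∀ n → P n ≡ true → S n ≡ true × 1 ≤ block n

      FewPerBlock : ℕ → Subset ℕ → Set
      FewPerBlock k P = ∀ j → AtMost k (λ n → ⟦ P n ≡ true × block n ≡ j ⟧)

      -- Elements of Q two blocks apart are separated by a whole block, which is where S
      -- stops being covered by the nodes below the earlier one.
      spread⇒escaping : ∀ {Q} → InLaterBlocks Q →
        (∀ a a′ → Q a ≡ true → Q a′ ≡ true → a < a′ → 2 + block a ≤ block a′) → Escaping Q
      spread⇒escaping {Q} later spread = first , next
        where
        first : ∀ a → Q a ≡ true → ¬ Covered 0 a
        first a Qa with Sa , 1≤block ← later a Qa
          = beyond-threshold 0 a
              (≤-trans (threshold≤blockStart 0) (≤-trans (blockStart-mono 1≤block) (blockStart≤ a))) Sa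

        next : ∀ a a′ → Q a ≡ true → Q a′ ≡ true → a < a′ → ¬ Covered (suc a) a′
        next a a′ Qa Qa′ a<a′ covered =
          beyond-threshold (blockStart (suc (block a))) a′
            (≤-trans (threshold≤blockStart (suc (block a)))
                     (≤-trans (blockStart-mono (spread a a′ Qa Qa′ a<a′)) (blockStart≤ a′)))
            (proj₁ (later a′ Qa′)) (Covered-mono (<blockEnd a) covered)

      First : Subset ℕ → Subset ℕ
      First P n = ⟦ P n ≡ true × (∀ x → x < n → block x ≡ block n → P x ≢ true) ⟧

      Later : Subset ℕ → Subset ℕ
      Later P n = ⟦ P n ≡ true × First P n ≡ false ⟧

      firsts∈I : ∀ {P} → InLaterBlocks P → I (First P)
      firsts∈I {P} later = ⊆-∪ (escaping∈I (spread⇒escaping (later′ true) (spread true)))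
                               (escaping∈I (spread⇒escaping (later′ false) (spread false))) split
        where
        OfParity : Bool → Subset ℕ
        OfParity b n = ⟦ First P n ≡ true × parity (block n) ≡ b ⟧

        later′ : ∀ b → InLaterBlocks (OfParity b)
        later′ b n e = later n (proj₁ (⟦⟧-elim (proj₁ (⟦⟧-elim e))))

        spread : ∀ b a a′ → OfParity b a ≡ true → OfParity b a′ ≡ true → a < a′ → 2 + block a ≤ block a′
        spread b a a′ e e′ a<a′ with first , parity≡b ← ⟦⟧-elim e | first′ , parity′≡b ← ⟦⟧-elim e′
          = same-parity⇒2+≤ (block a) (block a′) (trans parity≡b (sym parity′≡b))
              (≤∧≢⇒< (block-mono (<⇒≤ a<a′))
                     (λ same → proj₂ (⟦⟧-elim first′) a a<a′ same (proj₁ (⟦⟧-elim first))))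

        split : ∀ n → First P n ≡ true → OfParity true n ≡ true ⊎ OfParity false n ≡ true
        split n Fn = by-cases (parity (block n) ≡ true) (λ even → inj₁ (⟦⟧-intro (Fn , even)))
                       λ odd → inj₂ (⟦⟧-intro (Fn , ¬-not odd))

      later-fewer : ∀ k {P} → FewPerBlock (suc k) P → FewPerBlock k (Later P)
      later-fewer k     few j []      _      _   = z≤n
      later-fewer k {P} few j (y ∷ l) unique inL =
        ≤-pred (few j (x₀ ∷ y ∷ l) (x₀∉ ∷ unique) (⟦⟧-intro (proj₁ (proj₂ least)) ∷ All.map inP inL))
        where
        inP : ∀ {z} → ⟦ Later P z ≡ true × block z ≡ j ⟧ ≡ true → ⟦ P z ≡ true × block z ≡ j ⟧ ≡ true
        inP e with later , in-j ← ⟦⟧-elim e = ⟦⟧-intro (proj₁ (⟦⟧-elim later) , in-j)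

        least : ∃ λ x → (P x ≡ true × block x ≡ j) × (∀ x′ → x′ < x → ¬ (P x′ ≡ true × block x′ ≡ j))
        least = least-witness _ (λ _ → em) (y , ⟦⟧-elim (inP (All.head inL)))

        x₀ : ℕ
        x₀ = proj₁ least

        x₀-first : First P x₀ ≡ true
        x₀-first = let (Px₀ , in-j) , below = proj₂ least in
          ⟦⟧-intro (Px₀ , λ x x<x₀ same Px → below x x<x₀ (Px , trans same in-j))

        x₀∉ : All (x₀ ≢_) (y ∷ l)
        x₀∉ = All.map (λ e x₀≡z → case trans (sym (subst (λ w → First P w ≡ true) x₀≡z x₀-first))
                                              (proj₂ (⟦⟧-elim (proj₁ (⟦⟧-elim e)))) of λ ()) inL

      few-per-block∈I : ∀ k {P} → InLaterBlocks P → FewPerBlock k P → I P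
      few-per-block∈I zero    {P} _     few =
        ∅∈ λ n Pn → case few (block n) (n ∷ []) ([] ∷ []) (⟦⟧-intro (Pn , refl) ∷ []) of λ ()
      few-per-block∈I (suc k) {P} later few =
        ⊆-∪ (firsts∈I later) (few-per-block∈I k later′ (later-fewer k few)) split
        where
        later′ : InLaterBlocks (Later P)
        later′ n e = later n (proj₁ (⟦⟧-elim e))

        split : ∀ n → P n ≡ true → First P n ≡ true ⊎ Later P n ≡ true
        split n Pn = by-cases (First P n ≡ true) inj₁ λ not-first → inj₂ (⟦⟧-intro (Pn , ¬-not not-first))

      preimage : Subset (ℕ × ℕ) → Subset ℕ
      preimage A n = ⟦ S n ≡ true × A (block n , n) ≡ true ⟧

      preimage∈I : ∀ A → ED A → I (preimage A)
      preimage∈I A (k , m , few) = ⊆-∪ initial∈I tail∈I split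
        where
        initial : Subset ℕ
        initial n = ⟦ n < blockStart (suc m) ⟧

        initial∈I : I initial
        initial∈I = bounded∈ isI (blockStart (suc m)) λ n → ⟦⟧-elim

        tail : Subset ℕ
        tail n = ⟦ preimage A n ≡ true × suc m ≤ block n ⟧

        tail∈I : I tail
        tail∈I = few-per-block∈I k later few-in-block
          where
          later : InLaterBlocks tail
          later n e with in-preimage , m<block ← ⟦⟧-elim e
            = proj₁ (⟦⟧-elim in-preimage) , ≤-trans (s≤s z≤n) m<block

          few-in-block : FewPerBlock k tail
          few-in-block j = by-cases (m ≤ j) (λ m≤j → AtMost-mono in-column (few j m≤j))
            λ m≰j → AtMost-empty λ n e → m≰j (<⇒≤ (subst (suc m ≤_) (proj₂ (⟦⟧-elim e))
                                                  (proj₂ (⟦⟧-elim (proj₁ (⟦⟧-elim e))))))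
            where
            in-column : ∀ n → ⟦ tail n ≡ true × block n ≡ j ⟧ ≡ true → A (j , n) ≡ true
            in-column n e with in-tail , in-j ← ⟦⟧-elim e
              = subst (λ x → A (x , n) ≡ true) in-j (proj₂ (⟦⟧-elim (proj₁ (⟦⟧-elim in-tail))))

        split : ∀ n → preimage A n ≡ true → initial n ≡ true ⊎ tail n ≡ true
        split n e = by-cases (suc m ≤ block n) (λ m<block → inj₂ (⟦⟧-intro (e , m<block)))
          λ m≮block → inj₁ (⟦⟧-intro (<-≤-trans (<blockEnd n) (blockStart-mono (≰⇒> m≮block))))

      ED≤K : ED ≤K Restrict I S
      ED≤K = (λ y → block (proj₁ y) , proj₁ y) ,
             λ A A∈ED → preimage A , preimage∈I A A∈ED ,
                        λ y → mk⇔ (λ a → ⟦⟧-intro (proj₂ y , a)) (λ e → proj₂ (⟦⟧-elim e))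

    module ColumnMap (none : ¬ Σ (Subset ℕ) λ S → Positive I S × EventuallyUncovered S) where

      NeverCovered : Subset ℕ
      NeverCovered n = ⟦ (∀ L → ¬ Covered L n) ⟧

      neverCovered∈I : I NeverCovered
      neverCovered∈I = dne λ positive →
        none (NeverCovered , positive , λ L → 0 , λ n _ never → ⟦⟧-elim never L)

      -- Junk value 0 when n is never covered.
      column : ℕ → ℕ
      column n with em {∃ λ L → Covered L n}
      ... | yes covered = proj₁ (least-witness _ (λ _ → em) covered)
      ... | no _        = 0

      column-least : ∀ n L → Covered L n → Covered (column n) n × column n ≤ L
      column-least n L covered with em {∃ λ L → Covered L n}
      ... | no uncovered = ⊥-elim (uncovered (L , covered))
      ... | yes covered′ with _ , covered-at , below ← least-witness _ (λ _ → em) covered′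
        = covered-at , ≮⇒≥ λ L<column → below L L<column covered

      preimage : Subset (ℕ × ℕ) → Subset ℕ
      preimage A n = A (column n , n)

      module _ (A : Subset (ℕ × ℕ)) (k m : ℕ) (few : ∀ n → m ≤ n → AtMost k (λ j → A (n , j))) where

        stray : Subset ℕ
        stray n = ⟦ preimage A n ≡ true × ¬ Covered m n × ¬ (∀ L → ¬ Covered L n) ⟧

        -- Past m, a stray n covered at level L + 1 but not at level L lies in column L + 1 of A,
        -- which has at most k elements.
        stray-eventually-uncovered : EventuallyUncovered stray
        stray-eventually-uncovered zero =
          0 , λ n _ e → proj₁ (proj₂ (⟦⟧-elim e)) ∘ Covered-mono z≤n
        stray-eventually-uncovered (suc L) with suc L ≤? m
        ... | yes L<m = 0 , λ n _ e → proj₁ (proj₂ (⟦⟧-elim e)) ∘ Covered-mono L<m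
        ... | no L≮m
          with M₁ , uncovered-L ← stray-eventually-uncovered L
          with M₂ , column-ends ← AtMost⇒bounded k _ (few (suc L) (<⇒≤ (≰⇒> L≮m)))
          = M₁ + M₂ , uncovered-suc
          where
          uncovered-suc : ∀ n → M₁ + M₂ ≤ n → stray n ≡ true → ¬ Covered (suc L) n
          uncovered-suc n M≤n e covered with covered-at , column≤ ← column-least n (suc L) covered
                                          with m≤n⇒m<n∨m≡n column≤
          ... | inj₁ column≤L = uncovered-L n (≤-trans (m≤m+n M₁ M₂) M≤n) e
                                  (Covered-mono (≤-pred column≤L) covered-at)
          ... | inj₂ column≡ = column-ends n (≤-trans (m≤n+m M₂ M₁) M≤n)
                                 (subst (λ x → A (x , n) ≡ true) column≡ (proj₁ (⟦⟧-elim e)))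

        preimage∈I : I (preimage A)
        preimage∈I = ⊆-∪ (union (CoveredAt m) NeverCovered (covered∈I m) neverCovered∈I) stray∈I split
          where
          stray∈I : I stray
          stray∈I = dne λ positive → none (stray , positive , stray-eventually-uncovered)

          split : ∀ n → preimage A n ≡ true → (CoveredAt m ∪ NeverCovered) n ≡ true ⊎ stray n ≡ true
          split n An =
            by-cases (Covered m n) (λ covered → inj₁ (∪-introˡ (CoveredAt m) NeverCovered n (⟦⟧-intro covered)))
              λ uncovered → by-cases (∀ L → ¬ Covered L n)
                (λ never → inj₁ (∪-introʳ (CoveredAt m) NeverCovered n (⟦⟧-intro never)))
                (λ sometime → inj₂ (⟦⟧-intro (An , uncovered , sometime)))

      ED≤K : ED ≤K Restrict I full
      ED≤K = (λ y → column (proj₁ y) , proj₁ y) ,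
             λ { A (k , m , few) → preimage A , preimage∈I A k m few , λ _ → mk⇔ (λ a → a) (λ a → a) }

    ED-below-restriction : Σ (Subset ℕ) λ X → Positive I X × (ED ≤K Restrict I X)
    ED-below-restriction with em {Σ (Subset ℕ) λ S → Positive I S × EventuallyUncovered S}
    ... | yes (S , S∉I , uncovered) = S , S∉I , BlockMap.ED≤K S uncovered
    ... | no none                  = full , proper , ColumnMap.ED≤K none

proposition3p8 : ExcludedMiddle 0ℓ → (I : Family ℕ) → IsIdeal I → ¬ HL I →
    Σ (Subset ℕ) λ X → Positive I X × (ED ≤K Restrict I X)
proposition3p8 em I isI ¬HL with em {Σ (Node → Bool) λ c → ¬ HasHomogeneousTree I c}
... | yes (c , no-tree) = Colouring.ED-below-restriction em I isI c no-tree
... | no every-c-has    = ⊥-elim (¬HL λ c → em⇒dne em λ no-tree → every-c-has (c , no-tree))
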